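{- For every square matrix $M\in\Sigma^{n\times n}$, $\delta_{2D}(M)\le\gamma_{2D}(M)$.
   Context: For $M\in\Sigma^{n\times n}$, $M[i:i+a-1][j:j+b-1]$ denotes the $a\times b$ submatrix with rows $i,\dots,i+a-1$ and columns $j,\dots,j+b-1$. An occurrence of an $\ell\times\ell$ matrix $I$ in $M$ is a position $(i',j')$ with $M[i':i'+\ell-1][j':j'+\ell-1]=I$; it crosses position $p=(a,b)$ if $i'\le a\le i'+\ell-1$ and $j'\le b\le j'+\ell-1$. A two-dimensional attractor for $M$ is a set $\Gamma_{2D}\subseteq\{1,\dots,n\}\times\{1,\dots,n\}$ such that every square submatrix of $M$ has an occurrence crossing some position of $\Gamma_{2D}$; $\gamma_{2D}(M)$ is the minimum cardinality of such an attractor. For $k\in[1,n]$ let $d_{k\times k}(M)$ be the number of distinct $k\times k$ submatrices of $M$, and $\delta_{2D}(M)=\max\{d_{k\times k}(M)/k^2 : k\in[1,n]\}$. -}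

module Defs where

open import Data.Nat using (ℕ; zero; suc; _+_; _*_; _∸_; _≤_; _<_)
open import Data.Nat.Properties using (_<?_)
open import Data.Fin using (Fin; fromℕ<; toℕ)
open import Data.Maybe using (Maybe; just; nothing)
import Data.Maybe.Properties as MP
open import Data.List using (List; map; upTo; length; deduplicate; cartesianProduct)
import Data.List.Properties as LP
open import Data.List.Membership.Propositional using (_∈_)
open import Data.Product using (Σ; ∃; ∃-syntax; _×_; _,_; proj₁; proj₂)
open import Relation.Nullary using (yes; no)
open import Relation.Binary.Definitions using (DecidableEquality)
open import Relation.Binary.PropositionalEquality using (_≡_)

Matrix : Set → ℕ → Set
Matrix A n = Fin n → Fin n → A

entry : ∀ {A n} → Matrix A n → ℕ → ℕ → Maybe A
entry {n = n} M i j with i <? n | j <? n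
... | yes i<n | yes j<n = just (M (fromℕ< i<n) (fromℕ< j<n))
... | _       | _       = nothing

-- The k×k submatrix M[i : i+k-1][j : j+k-1] (0-indexed), as a list of rows.
-- For i + k ≤ n and j + k ≤ n all entries are 'just'.
sub : ∀ {A n} → Matrix A n → (k i j : ℕ) → List (List (Maybe A))
sub M k i j = map (λ a → map (λ b → entry M (i + a) (j + b)) (upTo k)) (upTo k)

subDec : ∀ {A : Set} → DecidableEquality A → DecidableEquality (List (List (Maybe A)))
subDec _≟_ = LP.≡-dec (LP.≡-dec (MP.≡-dec _≟_))

-- d_{k×k}(M): number of distinct k×k submatrices of M
-- (top-left corners (i,j) with i + k ≤ n and j + k ≤ n).
d : ∀ {A n} → DecidableEquality A → Matrix A n → ℕ → ℕ
d {n = n} _≟_ M k =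
  length (deduplicate {R = _≡_} (subDec _≟_)
    (map (λ p → sub M k (proj₁ p) (proj₂ p))
         (cartesianProduct (upTo (suc n ∸ k)) (upTo (suc n ∸ k)))))

OccCrosses : ∀ {A n} → Matrix A n → (k i j : ℕ) → Fin n × Fin n → Set
OccCrosses {n = n} M k i j (a , b) =
  ∃[ i' ] ∃[ j' ] (i' + k ≤ n × j' + k ≤ n × sub M k i' j' ≡ sub M k i j ×
                   i' ≤ toℕ a × toℕ a < i' + k × j' ≤ toℕ b × toℕ b < j' + k)

IsAttractor2D : ∀ {A n} → Matrix A n → List (Fin n × Fin n) → Set
IsAttractor2D {n = n} M Γ =
  ∀ k i j → 1 ≤ k → i + k ≤ n → j + k ≤ n →
  ∃[ p ] (p ∈ Γ × OccCrosses M k i j p)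

module Submission where

open import Defs
open import Data.Nat using (ℕ; suc; _+_; _*_; _∸_; _≤_; _<_; z≤n; s≤s)
open import Data.Nat.Properties
  using (≤-pred; ≤-trans; m≤n⇒m≤1+n; m≤o∸n⇒m+n≤o; ∸-monoˡ-<; m+n∸m≡n; m∸[m∸n]≡n; *-comm)
open import Data.Fin using (Fin; toℕ)
open import Data.Maybe using (Maybe)
open import Data.Product using (_×_; _,_; proj₁; proj₂)
open import Data.List using (List; []; _∷_; length; map; filter; upTo; cartesianProduct)
open import Data.List.Properties using (length-++; length-map; length-upTo; filter-notAll)
import Data.List.Relation.Unary.All as All
import Data.List.Relation.Unary.Any as Any
open import Data.List.Relation.Unary.AllPairs using (_∷_)
open import Data.List.Relation.Unary.Unique.Propositional using (Unique)
import Data.List.Relation.Unary.Unique.DecPropositional.Properties as Unique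
open import Data.List.Membership.Propositional using (_∈_)
open import Data.List.Membership.Propositional.Properties
  using (∈-filter⁺; ∈-deduplicate⁻; ∈-map⁻; ∈-map⁺; ∈-cartesianProduct⁻; ∈-cartesianProduct⁺; ∈-upTo⁻; ∈-upTo⁺)
open import Relation.Binary.Definitions using (DecidableEquality)
open import Relation.Binary.PropositionalEquality using (_≡_; refl; trans; cong; cong₂; subst; module ≡-Reasoning)
open import Relation.Nullary using (¬?)

-- Every k×k submatrix has an occurrence crossing some p ∈ Γ, and the
-- occurrences crossing p are the k² windows whose top-left corner is p
-- shifted up and left by offsets in [0, k). Hence the distinct k×k
-- submatrices all lie in a list of k² · |Γ| windows.

Unique-⊆⇒length-≤ : {B : Set} → DecidableEquality B → {xs ys : List B} →
                    Unique xs → (∀ {z} → z ∈ xs → z ∈ ys) → length xs ≤ length ys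
Unique-⊆⇒length-≤ _≟_ {[]}     _           _     = z≤n
Unique-⊆⇒length-≤ _≟_ {x ∷ xs} {ys} (x∉xs ∷ u) xs⊆ys =
  ≤-trans (s≤s (Unique-⊆⇒length-≤ _≟_ u xs⊆ys-without-x))
          (filter-notAll (λ y → ¬? (x ≟ y)) ys
            (Any.map (λ x≡y x≢y → x≢y x≡y) (xs⊆ys (Any.here refl))))
  where
  xs⊆ys-without-x : ∀ {z} → z ∈ xs → z ∈ filter (λ y → ¬? (x ≟ y)) ys
  xs⊆ys-without-x z∈xs = ∈-filter⁺ _ (xs⊆ys (Any.there z∈xs)) (All.lookup x∉xs z∈xs)

length-cartesianProduct : {X Y : Set} (xs : List X) (ys : List Y) →
                          length (cartesianProduct xs ys) ≡ length xs * length ys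
length-cartesianProduct []       ys = refl
length-cartesianProduct (x ∷ xs) ys = trans (length-++ (map (x ,_) ys))
  (cong₂ _+_ (length-map (x ,_) ys) (length-cartesianProduct xs ys))

m<1+n∸o⇒m+o≤n : ∀ {m n o} → o ≤ suc n → m < suc n ∸ o → m + o ≤ n
m<1+n∸o⇒m+o≤n {m} o≤1+n m<1+n∸o = ≤-pred (m≤o∸n⇒m+n≤o (suc m) o≤1+n m<1+n∸o)

m≤n<m+o⇒n∸m<o : ∀ {m n o} → m ≤ n → n < m + o → n ∸ m < o
m≤n<m+o⇒n∸m<o {m} {n} {o} m≤n n<m+o = subst (n ∸ m <_) (m+n∸m≡n m o) (∸-monoˡ-< n<m+o m≤n)

Window : Set → Set
Window A = List (List (Maybe A))

offsets : ℕ → List (ℕ × ℕ)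
offsets k = cartesianProduct (upTo k) (upTo k)

module _ {A : Set} {n : ℕ} (M : Matrix A n) (k : ℕ) where

  shiftedWindow : (Fin n × Fin n) × (ℕ × ℕ) → Window A
  shiftedWindow ((a , b) , (r , s)) = sub M k (toℕ a ∸ r) (toℕ b ∸ s)

  windowsCrossing : List (Fin n × Fin n) → List (Window A)
  windowsCrossing Γ = map shiftedWindow (cartesianProduct Γ (offsets k))

  length-windowsCrossing : ∀ Γ → length (windowsCrossing Γ) ≡ k * k * length Γ
  length-windowsCrossing Γ = begin
    length (windowsCrossing Γ)                 ≡⟨ length-map shiftedWindow (cartesianProduct Γ (offsets k)) ⟩
    length (cartesianProduct Γ (offsets k))    ≡⟨ length-cartesianProduct Γ (offsets k) ⟩
    length Γ * length (offsets k)              ≡⟨ cong (length Γ *_) length-offsets ⟩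
    length Γ * (k * k)                         ≡⟨ *-comm (length Γ) (k * k) ⟩
    k * k * length Γ                           ∎
    where
    open ≡-Reasoning
    length-offsets : length (offsets k) ≡ k * k
    length-offsets = trans (length-cartesianProduct (upTo k) (upTo k))
                           (cong₂ _*_ (length-upTo k) (length-upTo k))

  crossing⇒∈windowsCrossing : ∀ {Γ i j p} → p ∈ Γ → OccCrosses M k i j p →
                              sub M k i j ∈ windowsCrossing Γ
  crossing⇒∈windowsCrossing {Γ} {p = a , b} p∈Γ (i' , j' , _ , _ , same , i'≤a , a< , j'≤b , b<) =
    subst (_∈ windowsCrossing Γ) (trans corner-recovered same)
      (∈-map⁺ shiftedWindow (∈-cartesianProduct⁺ p∈Γ
        (∈-cartesianProduct⁺ (∈-upTo⁺ (m≤n<m+o⇒n∸m<o i'≤a a<)) (∈-upTo⁺ (m≤n<m+o⇒n∸m<o j'≤b b<)))))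
    where
    corner-recovered : sub M k (toℕ a ∸ (toℕ a ∸ i')) (toℕ b ∸ (toℕ b ∸ j')) ≡ sub M k i' j'
    corner-recovered = cong₂ (sub M k) (m∸[m∸n]≡n i'≤a) (m∸[m∸n]≡n j'≤b)

  submatrices : List (Window A)
  submatrices = map (λ c → sub M k (proj₁ c) (proj₂ c))
                    (cartesianProduct (upTo (suc n ∸ k)) (upTo (suc n ∸ k)))

  submatrices⊆windowsCrossing : ∀ {Γ} → IsAttractor2D M Γ → 1 ≤ k → k ≤ suc n →
                                ∀ {w} → w ∈ submatrices → w ∈ windowsCrossing Γ
  submatrices⊆windowsCrossing attractor 1≤k k≤1+n w∈
    with (i , j) , ij∈ , refl ← ∈-map⁻ _ w∈
    with i∈ , j∈ ← ∈-cartesianProduct⁻ (upTo (suc n ∸ k)) (upTo (suc n ∸ k)) ij∈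
    with p , p∈Γ , crosses ← attractor k i j 1≤k (m<1+n∸o⇒m+o≤n k≤1+n (∈-upTo⁻ i∈))
                                                 (m<1+n∸o⇒m+o≤n k≤1+n (∈-upTo⁻ j∈))
    = crossing⇒∈windowsCrossing p∈Γ crosses

lemma3 : {A : Set} (_≟_ : DecidableEquality A) (n : ℕ) (M : Matrix A n)
         (Γ : List (Fin n × Fin n)) → Unique Γ → IsAttractor2D M Γ →
         (k : ℕ) → 1 ≤ k → k ≤ n → d _≟_ M k ≤ k * k * length Γ
lemma3 _≟_ n M Γ _ attractor k 1≤k k≤n =
  subst (d _≟_ M k ≤_) (length-windowsCrossing M k Γ)
    (Unique-⊆⇒length-≤ (subDec _≟_) (Unique.deduplicate-! (subDec _≟_) _)
      (λ w∈ → submatrices⊆windowsCrossing M k attractor 1≤k (m≤n⇒m≤1+n k≤n)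
                (∈-deduplicate⁻ (subDec _≟_) _ w∈)))
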